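{- For any $C\in\{\{0,1\},\{0\},\{1\}\}$ and any natural number $n$, there exists a switching network $P$ with $n$ input variables such that $L(P)=n^2+n$ and $h_C(Q)\geq\binom{n}{\lceil n/2\rceil}$ for any switching network $Q$ implementing the same function as $P$.
   Context: A switching network is an undirected connected multigraph $P$ without loops with two distinct fixed nodes called poles, each edge labeled with a literal $x_i$ or $\bar x_i$ ($i\in\{0,1,2,\ldots\}$). $L(P)$ denotes the number of edges. The input variables $x_{i_1},\ldots,x_{i_m}$ of $P$ are all variables occurring in the edge literals. For $C\in\{\{0,1\},\{0\},\{1\}\}$, a $C$-fault of $P$ consists in assigning constants from $C$ to some edges of $P$ instead of their literals (the empty fault $\lambda$, assigning nothing, is allowed). For a $C$-fault $\rho$, $f_{P,\rho}$ is the Boolean function of the input variables equal to the disjunction, over all simple paths $\xi$ between the poles, of the conjunction of the Boolean functions (literals or constants) attached to the edges of $\xi$ in $P$ with fault $\rho$; $f_P=f_{P,\lambda}$ is the function implemented by $P$. A decision tree (for diagnosis of $C$-faults of $P$) is a rooted directed tree whose terminal nodes are labeled with $C$-faults of $P$ and whose nonterminal nodes are labeled with tuples from $\{0,1\}^m$, with two outgoing edges labeled $0$ and $1$; on $P$ with fault $\rho$ it starts at the root, at each nonterminal node follows the edge labeled with the value of $f_{P,\rho}$ on the node's tuple, and outputs the fault labeling the reached terminal node. Its depth is the maximum length of a root-to-terminal path. $h_C(P)$ is the minimum depth of a decision tree such that for every $C$-fault $\rho$ of $P$ (including the empty fault) its output $\delta$ satisfies $f_{P,\rho}=f_{P,\delta}$.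 -}

module Defs where

open import Data.Nat using (ℕ; zero; suc; _+_; _⊔_; _≡ᵇ_)
open import Data.Bool using (Bool; true; false; not; if_then_else_)
open import Data.Fin using (Fin)
open import Data.Maybe using (Maybe; just; nothing; maybe)
open import Data.List using (List; []; _∷_; length; map; deduplicate)
open import Data.List.Relation.Unary.All using (All)
open import Data.List.Relation.Unary.Unique.Propositional using (Unique)
open import Data.Vec using (Vec; []; _∷_)
open import Data.Product using (Σ; _×_; _,_; ∃; ∃-syntax)
open import Data.Sum using (_⊎_)
open import Relation.Nullary using (¬_)
open import Data.Unit using (⊤)
open import Relation.Binary.PropositionalEquality using (_≡_; _≢_)
open import Function.Bundles using (_⇔_)
import Data.Nat as N
import Data.List as L

record Literal : Set where
  constructor lit
  field
    var : ℕ
    pos : Bool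

litVal : Literal → (ℕ → Bool) → Bool
litVal (lit i true)  σ = σ i
litVal (lit i false) σ = not (σ i)

module Graph {k m : ℕ} (src tgt : Fin m → Fin k) where

  Joins : Fin m → Fin k → Fin k → Set
  Joins e u w = (src e ≡ u × tgt e ≡ w) ⊎ (src e ≡ w × tgt e ≡ u)

  data Walk : Fin k → Fin k → List (Fin m) → List (Fin k) → Set where
    stop : ∀ {u} → Walk u u [] (u ∷ [])
    step : ∀ {u w v es vs} (e : Fin m) → Joins e u w →
           Walk w v es vs → Walk u v (e ∷ es) (u ∷ vs)

  SimplePath : Fin k → Fin k → List (Fin m) → Set
  SimplePath u v es = Σ (List (Fin k)) λ vs → Walk u v es vs × Unique vs

record Network : Set where
  field
    nodes   : ℕ
    L       : ℕ
    src tgt : Fin L → Fin nodes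
    label   : Fin L → Literal
    s t     : Fin nodes
    poles≢  : s ≢ t
    noLoops : ∀ e → src e ≢ tgt e
  open Graph src tgt public
  field
    connected : ∀ u v → ∃[ es ] ∃[ vs ] Walk u v es vs

open Network public

inputVars : Network → List ℕ
inputVars P = deduplicate N._≟_ (map (λ e → Literal.var (label P e)) (L.allFin (L P)))

nVars : Network → ℕ
nVars P = length (inputVars P)

-- the assignment of variables given by a tuple for the variables xs
-- (variables not in xs get 0; they do not occur in the network)
assign : (xs : List ℕ) → Vec Bool (length xs) → ℕ → Bool
assign []       []       i = false
assign (x ∷ xs) (b ∷ bs) i = if i ≡ᵇ x then b else assign xs bs i

data FaultType : Set where
  C01 C0 C1 : FaultType

Allowed : FaultType → Bool → Set
Allowed C01 _     = ⊤
Allowed C0  b     = b ≡ false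
Allowed C1  b     = b ≡ true

-- a C-fault: some edges get a constant from C (just b), others keep
-- their literal (nothing).  The empty fault assigns nothing.
record Fault (C : FaultType) (P : Network) : Set where
  field
    const   : Fin (L P) → Maybe Bool
    allowed : ∀ e b → const e ≡ just b → Allowed C b

open Fault public

emptyFault : ∀ {C} P → Fault C P
emptyFault P = record { const = λ _ → nothing ; allowed = λ _ _ () }

edgeVal : ∀ {C} (P : Network) → Fault C P → Fin (L P) → (ℕ → Bool) → Bool
edgeVal P ρ e σ = maybe (λ b → b) (litVal (label P e) σ) (const ρ e)

Conducts : ∀ {C} (P : Network) → Fault C P → (ℕ → Bool) → Set
Conducts P ρ σ = ∃[ es ] (SimplePath P (s P) (t P) es ×
                          All (λ e → edgeVal P ρ e σ ≡ true) es)

SameFault : ∀ {C} (P : Network) → Fault C P → Fault C P → Set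
SameFault P ρ δ = ∀ (τ : Vec Bool (nVars P)) →
  Conducts P ρ (assign (inputVars P) τ) ⇔ Conducts P δ (assign (inputVars P) τ)

-- f_Q = f_P (as Boolean functions; fictitious variables ignored)
SameFunction : Network → Network → Set
SameFunction Q P = ∀ (σ : ℕ → Bool) →
  Conducts Q (emptyFault {C01} Q) σ ⇔ Conducts P (emptyFault {C01} P) σ

data DTree (C : FaultType) (P : Network) : Set where
  leaf : Fault C P → DTree C P
  -- node τ t₀ t₁ : query f at tuple τ; go to t₀ on 0, to t₁ on 1
  node : Vec Bool (nVars P) → DTree C P → DTree C P → DTree C P

depth : ∀ {C P} → DTree C P → ℕ
depth (leaf _)     = 0
depth (node _ a b) = suc (depth a ⊔ depth b)

data Reaches {C P} : DTree C P → Fault C P → Fault C P → Set where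
  atLeaf : ∀ {ρ δ} → Reaches (leaf δ) ρ δ
  go1 : ∀ {τ t₀ t₁ ρ δ} → Conducts P ρ (assign (inputVars P) τ) →
        Reaches t₁ ρ δ → Reaches (node τ t₀ t₁) ρ δ
  go0 : ∀ {τ t₀ t₁ ρ δ} → ¬ Conducts P ρ (assign (inputVars P) τ) →
        Reaches t₀ ρ δ → Reaches (node τ t₀ t₁) ρ δ

Diagnoses : ∀ {C P} → DTree C P → Set
Diagnoses {C} {P} T = ∀ (ρ δ : Fault C P) → Reaches T ρ δ → SameFault P ρ δ

-- P is a "ladder" computing the parity of x₀, …, x_{n-1} (or its negation): besides the
-- source, level j has two nodes, one per value of x₀ ⊕ … ⊕ x_j, and an edge labelled
-- x_{j+1} = c leads from value p on level j to value p ⊕ c on level j + 1.  Its 4n - 2 edges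
-- are padded with parallel edges to n² + n.  A network Q with the same function rejects
-- every neighbour of an accepted point, and vice versa.
--
-- Faults containing 0.  Let ρ₀ stick every edge at 0, and for an accepted α let ρ_α stick at
-- 0 the edges whose literal fails at α.  Then f_{Q,ρ_α} is the indicator of α, while f_{Q,ρ₀}
-- is 0.  Both faults follow the all-0 branch of a diagnosing tree until α is queried, and the
-- tree must tell them apart, so that branch queries every accepted α; choosing the parity so
-- that all α of weight ⌈n/2⌉ are accepted gives at least C(n, ⌈n/2⌉) queries.
--
-- Faults containing 1.  Dually, the all-1 fault and, for a rejected α, the fault sticking
-- at 1 the edges whose literal holds at α (its function is 1 except at α) force the all-1
-- branch to query every rejected α.

module Submission where

open import Defs hiding (Joins; Walk; stop; step; SimplePath)
open import Data.Bool using (Bool; true; false; not; _xor_; _∧_; _∨_; if_then_else_; T)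
open import Data.Bool.Properties
  using (not-distribˡ-xor; not-distribʳ-xor; xor-assoc; xor-comm; xor-identityʳ; xor-same; not-involutive)
import Data.Bool.Properties as Bool
open import Data.Nat using (ℕ; zero; suc; pred; _+_; _*_; _≤_; _<_; _≡ᵇ_; z≤n; s≤s; _≥_; ⌈_/2⌉)
import Data.Nat as ℕ
open import Data.Nat.Properties
  using (+-mono-≤; +-suc; <-trans; <-irrefl; ≤-trans; ≤-reflexive; m≤m⊔n; m≤n⊔m; ≡ᵇ⇒≡; ≡⇒≡ᵇ; module ≤-Reasoning)
open import Data.Nat.Combinatorics using (_C_; nCk+nC[k+1]≡[n+1]C[k+1])
open import Data.Nat.Tactic.RingSolver using (solve-∀)
open import Data.Fin using (Fin; zero; suc; toℕ; fromℕ; fromℕ<; inject₁)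
open import Data.Fin.Properties using (toℕ-inject₁; toℕ-fromℕ; toℕ-fromℕ<; toℕ<n; 1↔⊤; 2↔Bool; +↔⊎; *↔×)
open import Data.Fin.Induction using (<-weakInduction; >-weakInduction)
open import Data.Maybe using (just; nothing)
open import Data.Maybe.Properties using (just-injective)
open import Data.Vec using (Vec; []; _∷_; replicate; countᵇ)
open import Data.Vec.Properties using (≡-dec)
open import Data.List using (List; []; _∷_; length; map; upTo)
open import Data.List.Properties using (length-upTo; length-map)
open import Data.List.Membership.Propositional using (_∈_)
open import Data.List.Membership.Propositional.Properties
  using (∈-length; ∈-map⁺; ∈-map⁻; ∈-allFin; ∈-upTo⁺; ∈-upTo⁻; ∈-deduplicate⁺; deduplicate-∈⇔)
open import Data.List.Membership.Propositional.Properties.WithK using (unique∧set⇒bag)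
open import Data.List.Relation.Binary.BagAndSetEquality using (_∼[_]_; bag; ∼bag⇒↭)
open import Data.List.Relation.Binary.Permutation.Propositional.Properties using (↭-length)
open import Data.List.Relation.Unary.All as All using (All; []; _∷_)
open import Data.List.Relation.Unary.AllPairs as AllPairs using ()
open import Data.List.Relation.Unary.Any using (here; there)
open import Data.List.Relation.Unary.Linked using (Linked; []; [-]; _∷_)
open import Data.List.Relation.Unary.Linked.Properties using (Linked⇒AllPairs)
open import Data.List.Relation.Unary.Unique.Propositional using (Unique)
open import Data.List.Relation.Unary.Unique.DecPropositional.Properties ℕ._≟_ using (deduplicate-!; upTo⁺)
open import Data.Product using (Σ; ∃; ∃-syntax; _×_; _,_; proj₂)
open import Data.Product.Function.NonDependent.Propositional using (_×-↔_)
open import Data.Sum using (_⊎_; inj₁; inj₂; [_,_]′)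
open import Data.Sum.Function.Propositional using (_⊎-↔_)
open import Data.Unit using (⊤; tt)
open import Function using (_∘_; _on_; id; case_of_; _↔_; Inverse; _⇔_; mk⇔; Equivalence)
import Function.Properties.Equivalence as ⇔
open import Function.Properties.Inverse using (↔-refl; ↔-trans)
open import Relation.Binary.PropositionalEquality
open import Relation.Nullary using (¬_; Dec; yes; no; contradiction)

xor-cancelʳ : ∀ p q c → (p xor c) xor (q xor c) ≡ p xor q
xor-cancelʳ p q c = trans (xor-assoc p c (q xor c)) (cong (p xor_) (c-q-c c q))
  where
  c-q-c : ∀ c q → c xor (q xor c) ≡ q
  c-q-c false q     = xor-identityʳ q
  c-q-c true  false = refl
  c-q-c true  true  = refl

xor≡false⇒≡ : ∀ a b → a xor b ≡ false → b ≡ a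
xor≡false⇒≡ false b eq = eq
xor≡false⇒≡ true  b eq = trans (sym (not-involutive b)) (cong not eq)

∧≡true⁻ : ∀ a {b} → a ∧ b ≡ true → a ≡ true × b ≡ true
∧≡true⁻ true b≡true = refl , b≡true

∨≡true⁻ : ∀ a {b} → a ∨ b ≡ true → a ≡ true ⊎ b ≡ true
∨≡true⁻ true  _      = inj₁ refl
∨≡true⁻ false b≡true = inj₂ b≡true

∨≡true⁺ : ∀ {a b} → a ≡ true ⊎ b ≡ true → a ∨ b ≡ true
∨≡true⁺     (inj₁ refl) = refl
∨≡true⁺ {a} (inj₂ refl) = Bool.∨-zeroʳ a

lit⁺ : ∀ {σ i c} → σ i ≡ c → litVal (lit i c) σ ≡ true
lit⁺ {c = true}  σi≡c = σi≡c
lit⁺ {c = false} σi≡c = cong not σi≡c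

lit⁻ : ∀ {σ i c} → litVal (lit i c) σ ≡ true → σ i ≡ c
lit⁻ {c = true}  holds = holds
lit⁻ {c = false} holds = trans (sym (not-involutive _)) (cong not holds)

litVal-cong : ∀ ℓ {σ γ} → σ (Literal.var ℓ) ≡ γ (Literal.var ℓ) → litVal ℓ σ ≡ litVal ℓ γ
litVal-cong (lit i true)  eq = eq
litVal-cong (lit i false) eq = cong not eq

satisfiers-agree : ∀ ℓ {σ γ} → litVal ℓ σ ≡ true → litVal ℓ γ ≡ true →
                   σ (Literal.var ℓ) ≡ γ (Literal.var ℓ)
satisfiers-agree (lit i true)  σ⊨ℓ γ⊨ℓ = trans σ⊨ℓ (sym γ⊨ℓ)
satisfiers-agree (lit i false) σ⊨ℓ γ⊨ℓ = Bool.not-injective (trans σ⊨ℓ (sym γ⊨ℓ))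

-- Parity of assignments

parity : ℕ → (ℕ → Bool) → Bool
parity zero    σ = false
parity (suc n) σ = σ 0 xor parity n (σ ∘ suc)

parity-snoc : ∀ n σ → parity (suc n) σ ≡ parity n σ xor σ n
parity-snoc zero    σ = xor-comm (σ 0) false
parity-snoc (suc n) σ = begin
  σ 0 xor parity (suc n) (σ ∘ suc)           ≡⟨ cong (σ 0 xor_) (parity-snoc n (σ ∘ suc)) ⟩
  σ 0 xor (parity n (σ ∘ suc) xor σ (suc n)) ≡⟨ xor-assoc (σ 0) _ _ ⟨
  parity (suc n) σ xor σ (suc n)             ∎
  where open ≡-Reasoning

toggle : ℕ → (ℕ → Bool) → ℕ → Bool
toggle zero    σ zero    = not (σ zero)
toggle zero    σ (suc j) = σ (suc j)
toggle (suc i) σ zero    = σ zero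
toggle (suc i) σ (suc j) = toggle i (σ ∘ suc) j

toggle-self : ∀ i σ → toggle i σ i ≡ not (σ i)
toggle-self zero    σ = refl
toggle-self (suc i) σ = toggle-self i (σ ∘ suc)

toggle-other : ∀ i σ {j} → j ≢ i → toggle i σ j ≡ σ j
toggle-other zero    σ {zero}  j≢i = contradiction refl j≢i
toggle-other zero    σ {suc j} j≢i = refl
toggle-other (suc i) σ {zero}  j≢i = refl
toggle-other (suc i) σ {suc j} j≢i = toggle-other i (σ ∘ suc) (j≢i ∘ cong suc)

parity-toggle : ∀ {n i} σ → i < n → parity n (toggle i σ) ≡ not (parity n σ)
parity-toggle {suc n} {zero}  σ _         = sym (not-distribˡ-xor (σ 0) _)
parity-toggle {suc n} {suc i} σ (s≤s i<n) =
  trans (cong (σ 0 xor_) (parity-toggle (σ ∘ suc) i<n)) (sym (not-distribʳ-xor (σ 0) _))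

parity-surjective : ∀ {n} → 0 < n → ∀ b → ∃[ σ ] parity n σ ≡ b
parity-surjective {n} 0<n b with parity n (λ _ → false) Bool.≟ b
... | yes hit  = _ , hit
... | no  miss = toggle 0 (λ _ → false) , trans (parity-toggle _ 0<n) (sym (Bool.¬-not (miss ∘ sym)))

odd : ℕ → Bool
odd zero    = false
odd (suc k) = not (odd k)

weight : ∀ {n} → Vec Bool n → ℕ
weight = countᵇ id

extend : ∀ {n} → Vec Bool n → ℕ → Bool
extend []      _       = false
extend (a ∷ α) zero    = a
extend (a ∷ α) (suc j) = extend α j

prefix : ∀ n → (ℕ → Bool) → Vec Bool n
prefix zero    σ = []
prefix (suc n) σ = σ 0 ∷ prefix n (σ ∘ suc)

parity-extend : ∀ {n} (α : Vec Bool n) → parity n (extend α) ≡ odd (weight α)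
parity-extend []          = refl
parity-extend (true ∷ α)  = cong not (parity-extend α)
parity-extend (false ∷ α) = parity-extend α

AgreeBelow : ℕ → (ℕ → Bool) → (ℕ → Bool) → Set
AgreeBelow n σ γ = ∀ i → i < n → σ i ≡ γ i

prefix-extend : ∀ {n} σ (α : Vec Bool n) → AgreeBelow n σ (extend α) → prefix n σ ≡ α
prefix-extend σ []      _     = refl
prefix-extend σ (a ∷ α) agree =
  cong₂ _∷_ (agree 0 (s≤s z≤n)) (prefix-extend (σ ∘ suc) α (λ i i<n → agree (suc i) (s≤s i<n)))

prefix-≢ : ∀ {n} σ (α : Vec Bool n) → prefix n σ ≢ α → ∃[ i ] i < n × σ i ≢ extend α i
prefix-≢ σ []      ≢α = contradiction refl ≢α
prefix-≢ σ (a ∷ α) ≢α with σ 0 Bool.≟ a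
... | no  σ₀≢a = 0 , s≤s z≤n , σ₀≢a
... | yes σ₀≡a with prefix-≢ (σ ∘ suc) α (≢α ∘ cong₂ _∷_ σ₀≡a)
...   | i , i<n , ≢ = suc i , s≤s i<n , ≢

-- Counting vectors of a given weight

trueTails falseTails : ∀ {n} → List (Vec Bool (suc n)) → List (Vec Bool n)
trueTails []                = []
trueTails ((true  ∷ α) ∷ X) = α ∷ trueTails X
trueTails ((false ∷ α) ∷ X) = trueTails X
falseTails []                = []
falseTails ((true  ∷ α) ∷ X) = falseTails X
falseTails ((false ∷ α) ∷ X) = α ∷ falseTails X

length-tails : ∀ {n} (X : List (Vec Bool (suc n))) →
               length (trueTails X) + length (falseTails X) ≡ length X
length-tails []                = refl
length-tails ((true  ∷ α) ∷ X) = cong suc (length-tails X)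
length-tails ((false ∷ α) ∷ X) = trans (+-suc _ _) (cong suc (length-tails X))

∈-trueTails : ∀ {n} {α : Vec Bool n} X → true ∷ α ∈ X → α ∈ trueTails X
∈-trueTails ((true  ∷ _) ∷ X) (here refl) = here refl
∈-trueTails ((true  ∷ _) ∷ X) (there α∈X) = there (∈-trueTails X α∈X)
∈-trueTails ((false ∷ _) ∷ X) (there α∈X) = ∈-trueTails X α∈X

∈-falseTails : ∀ {n} {α : Vec Bool n} X → false ∷ α ∈ X → α ∈ falseTails X
∈-falseTails ((false ∷ _) ∷ X) (here refl) = here refl
∈-falseTails ((false ∷ _) ∷ X) (there α∈X) = there (∈-falseTails X α∈X)
∈-falseTails ((true  ∷ _) ∷ X) (there α∈X) = ∈-falseTails X α∈X

weight-replicate : ∀ n → weight (replicate n false) ≡ 0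
weight-replicate zero    = refl
weight-replicate (suc n) = weight-replicate n

Covers : ∀ {n} → ℕ → List (Vec Bool n) → Set
Covers k X = ∀ α → weight α ≡ k → α ∈ X

covers⇒C≤length : ∀ n k (X : List (Vec Bool n)) → Covers k X → n C k ≤ length X
covers⇒C≤length n       zero    X covers = ∈-length (covers (replicate n false) (weight-replicate n))
covers⇒C≤length zero    (suc k) X covers = z≤n
covers⇒C≤length (suc n) (suc k) X covers = begin
  suc n C suc k                                 ≡⟨ nCk+nC[k+1]≡[n+1]C[k+1] n k ⟨
  n C k + n C suc k                             ≤⟨ +-mono-≤ (covers⇒C≤length n k _ coversᵗ)
                                                            (covers⇒C≤length n (suc k) _ coversᶠ) ⟩
  length (trueTails X) + length (falseTails X)  ≡⟨ length-tails X ⟩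
  length X                                      ∎
  where
  open ≤-Reasoning
  coversᵗ : Covers k (trueTails X)
  coversᵗ α wt = ∈-trueTails X (covers (true ∷ α) (cong suc wt))
  coversᶠ : Covers (suc k) (falseTails X)
  coversᶠ α wt = ∈-falseTails X (covers (false ∷ α) wt)

module Walks {k m : ℕ} (src tgt : Fin m → Fin k) where
  open Graph src tgt

  Reachable : Fin k → Fin k → Set
  Reachable u v = ∃[ es ] ∃[ vs ] Walk u v es vs

  along : ∀ {u w} e → Joins e u w → Reachable u w
  along e j = e ∷ [] , _ ∷ _ ∷ [] , step e j stop

  reachable-trans : ∀ {u v w} → Reachable u v → Reachable v w → Reachable u w
  reachable-trans (_ , _ , W) = prepend W
    where
    prepend : ∀ {u v w es vs} → Walk u v es vs → Reachable v w → Reachable u w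
    prepend stop         r = r
    prepend (step e j W) r with prepend W r
    ... | es , vs , W′ = e ∷ es , _ ∷ vs , step e j W′

  reachable-sym : ∀ {u v} → Reachable u v → Reachable v u
  reachable-sym (_ , _ , W) = reverse W
    where
    reverse : ∀ {u v es vs} → Walk u v es vs → Reachable v u
    reverse stop                            = [] , _ , stop
    reverse (step e (inj₁ (refl , refl)) W) = reachable-trans (reverse W) (along e (inj₂ (refl , refl)))
    reverse (step e (inj₂ (refl , refl)) W) = reachable-trans (reverse W) (along e (inj₁ (refl , refl)))

  connected-via : ∀ r → (∀ v → Reachable r v) → ∀ u v → Reachable u v
  connected-via r reach u v = reachable-trans (reachable-sym (reach u)) (reach v)

  walk-invariant : ∀ {A : Set} (c : Fin k → A) (Good : Fin m → Set) →
                   (∀ e → Good e → c (src e) ≡ c (tgt e)) →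
                   ∀ {u v es vs} → Walk u v es vs → All Good es → c u ≡ c v
  walk-invariant c Good preserve stop                            []       = refl
  walk-invariant c Good preserve (step e (inj₁ (refl , refl)) W) (g ∷ gs) =
    trans (preserve e g) (walk-invariant c Good preserve W gs)
  walk-invariant c Good preserve (step e (inj₂ (refl , refl)) W) (g ∷ gs) =
    trans (sym (preserve e g)) (walk-invariant c Good preserve W gs)

  linked-prepend : ∀ {R : Fin k → Fin k → Set} {u w v es vs} →
                   R u w → Walk w v es vs → Linked R vs → Linked R (u ∷ vs)
  linked-prepend Ruw stop         linked = Ruw ∷ linked
  linked-prepend Ruw (step _ _ _) linked = Ruw ∷ linked

ascending⇒unique : ∀ {A : Set} (f : A → ℕ) {xs} → Linked (_<_ on f) xs → Unique xs
ascending⇒unique f ascending =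
  AllPairs.map (λ f[x]<f[y] x≡y → <-irrefl (cong f x≡y) f[x]<f[y]) (Linked⇒AllPairs <-trans ascending)

nVars≡ : ∀ (P : Network) n → (∀ e → Literal.var (label P e) < n) →
         (∀ i → i < n → ∃[ e ] Literal.var (label P e) ≡ i) → nVars P ≡ n
nVars≡ P n bounded onto = trans (↭-length (∼bag⇒↭ dedup∼upTo)) (length-upTo n)
  where
  dedup∼upTo : inputVars P ∼[ bag ] upTo n
  dedup∼upTo = unique∧set⇒bag (deduplicate-! _) (upTo⁺ n) (mk⇔ ⇒ ⇐)
    where
    ⇒ : ∀ {i} → i ∈ inputVars P → i ∈ upTo n
    ⇒ i∈ with ∈-map⁻ (Literal.var ∘ label P) (Equivalence.from (deduplicate-∈⇔ ℕ._≟_) i∈)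
    ... | e , _ , refl = ∈-upTo⁺ (bounded e)
    ⇐ : ∀ {i} → i ∈ upTo n → i ∈ inputVars P
    ⇐ i∈ with onto _ (∈-upTo⁻ i∈)
    ... | e , refl = Equivalence.to (deduplicate-∈⇔ ℕ._≟_) (∈-map⁺ (Literal.var ∘ label P) (∈-allFin e))

-- The ladder network

-- rung j r is the node of level j reached when x₀ ⊕ … ⊕ x_j = r; enter c joins the source to
-- rung 0 c with literal x₀ = c, and climb j p c joins rung j p to rung (j + 1) (p ⊕ c) with
-- literal x_{j+1} = c.
Node : ℕ → Set
Node m = ⊤ ⊎ (Fin (suc m) × Bool)

pattern source   = inj₁ tt
pattern rung j r = inj₂ (j , r)

Edge : ℕ → Set
Edge m = Bool ⊎ (Fin m × Bool × Bool)

pattern enter c     = inj₁ c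
pattern climb j p c = inj₂ (j , p , c)

lower upper : ∀ {m} → Edge m → Node m
lower (enter c)     = source
lower (climb j p c) = rung (inject₁ j) p
upper (enter c)     = rung zero c
upper (climb j p c) = rung (suc j) (p xor c)

literal : ∀ {m} → Edge m → Literal
literal (enter c)     = lit 0 c
literal (climb j p c) = lit (suc (toℕ j)) c

level : ∀ {m} → Node m → ℕ
level source     = 0
level (rung j r) = suc (toℕ j)

level-lower<upper : ∀ {m} (x : Edge m) → level (lower x) < level (upper x)
level-lower<upper (enter c)     = s≤s z≤n
level-lower<upper (climb j p c) = s≤s (s≤s (≤-reflexive (toℕ-inject₁ j)))

edge-count : ∀ m → 2 + m * 4 + m * pred m ≡ suc m * suc m + suc m
edge-count zero    = refl
edge-count (suc k) = identity k
  where
  identity : ∀ k → 2 + suc k * 4 + suc k * k ≡ suc (suc k) * suc (suc k) + suc (suc k)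
  identity = solve-∀

module Ladder (m : ℕ) (b : Bool) where

  #nodes : ℕ
  #nodes = suc (suc m * 2)

  #edges : ℕ
  #edges = 2 + m * 4 + m * pred m

  node↔ : Fin #nodes ↔ Node m
  node↔ = ↔-trans +↔⊎ (1↔⊤ ⊎-↔ ↔-trans *↔× (↔-refl ×-↔ 2↔Bool))

  edge↔ : Fin #edges ↔ (Edge m ⊎ Fin (m * pred m))
  edge↔ = ↔-trans +↔⊎
    (↔-trans +↔⊎ (2↔Bool ⊎-↔ ↔-trans *↔× (↔-refl ×-↔ ↔-trans *↔× (2↔Bool ×-↔ 2↔Bool))) ⊎-↔ ↔-refl)

  code : Node m → Fin #nodes
  code = Inverse.from node↔

  decode : Fin #nodes → Node m
  decode = Inverse.to node↔

  decode-code : ∀ x → decode (code x) ≡ x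
  decode-code = Inverse.strictlyInverseˡ node↔

  code-injective : ∀ {x y} → code x ≡ code y → x ≡ y
  code-injective {x} {y} eq = trans (sym (decode-code x)) (trans (cong decode eq) (decode-code y))

  -- the m (m - 1) padding edges are parallel copies of enter false
  edgeAt : Fin #edges → Edge m
  edgeAt = [ id , (λ _ → enter false) ]′ ∘ Inverse.to edge↔

  edgeCode : Edge m → Fin #edges
  edgeCode = Inverse.from edge↔ ∘ inj₁

  edgeAt-edgeCode : ∀ x → edgeAt (edgeCode x) ≡ x
  edgeAt-edgeCode x = cong [ id , (λ _ → enter false) ]′ (Inverse.strictlyInverseˡ edge↔ (inj₁ x))

  lowerEnd upperEnd : Fin #edges → Fin #nodes
  lowerEnd = code ∘ lower ∘ edgeAt
  upperEnd = code ∘ upper ∘ edgeAt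

  open Graph lowerEnd upperEnd
  open Walks lowerEnd upperEnd

  edgeCode-joins : ∀ x → Joins (edgeCode x) (code (lower x)) (code (upper x))
  edgeCode-joins x =
    inj₁ (cong (code ∘ lower) (edgeAt-edgeCode x) , cong (code ∘ upper) (edgeAt-edgeCode x))

  edgeCode-reachable : ∀ x → Reachable (code (lower x)) (code (upper x))
  edgeCode-reachable x = along (edgeCode x) (edgeCode-joins x)

  height : Fin #nodes → ℕ
  height = level ∘ decode

  ascends : ∀ x → height (code (lower x)) < height (code (upper x))
  ascends x = subst₂ _<_ (sym (cong level (decode-code (lower x))))
                         (sym (cong level (decode-code (upper x))))
                         (level-lower<upper x)

  reach : ∀ x → Reachable (code source) (code x)
  reach source     = [] , _ , stop
  reach (rung j r) = <-weakInduction (λ j → ∀ r → Reachable (code source) (code (rung j r)))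
    (λ r → edgeCode-reachable (enter r))
    (λ i reach-i r → reachable-trans (reach-i false) (edgeCode-reachable (climb i false r)))
    j r

  ladder-connected : ∀ u v → Reachable u v
  ladder-connected = connected-via (code source) λ u →
    subst (Reachable (code source)) (Inverse.strictlyInverseʳ node↔ u) (reach (decode u))

  ladder : Network
  ladder = record
    { nodes     = #nodes
    ; L         = #edges
    ; src       = lowerEnd
    ; tgt       = upperEnd
    ; label     = literal ∘ edgeAt
    ; s         = code source
    ; t         = code (rung (fromℕ m) b)
    ; poles≢    = λ eq → case code-injective {source} {rung (fromℕ m) b} eq of λ ()
    ; noLoops   = λ e eq → <-irrefl (cong height eq) (ascends (edgeAt e))
    ; connected = ladder-connected
    }

  ladder-L : L ladder ≡ suc m * suc m + suc m
  ladder-L = edge-count m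

  ladder-nVars : nVars ladder ≡ suc m
  ladder-nVars = nVars≡ ladder (suc m) (bounded ∘ edgeAt) onto
    where
    bounded : ∀ x → Literal.var (literal x) < suc m
    bounded (enter c)     = s≤s z≤n
    bounded (climb j p c) = s≤s (toℕ<n j)
    var-edgeCode : ∀ x → Literal.var (literal (edgeAt (edgeCode x))) ≡ Literal.var (literal x)
    var-edgeCode x = cong (Literal.var ∘ literal) (edgeAt-edgeCode x)
    onto : ∀ i → i < suc m → ∃[ e ] Literal.var (literal (edgeAt e)) ≡ i
    onto zero    _         = edgeCode (enter false) , var-edgeCode (enter false)
    onto (suc i) (s≤s i<m) = edgeCode x , trans (var-edgeCode x) (cong suc (toℕ-fromℕ< i<m))
      where x = climb (fromℕ< i<m) false false

  rail : (ℕ → Bool) → Fin (suc m) → Bool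
  rail σ j = parity (suc (toℕ j)) σ

  rail-zero : ∀ σ → rail σ zero ≡ σ 0
  rail-zero σ = xor-identityʳ (σ 0)

  rail-inject₁ : ∀ σ j → rail σ (inject₁ j) ≡ parity (suc (toℕ j)) σ
  rail-inject₁ σ j = cong (λ t → parity (suc t) σ) (toℕ-inject₁ j)

  rail-climb : ∀ σ j → rail σ (inject₁ j) xor σ (suc (toℕ j)) ≡ rail σ (suc j)
  rail-climb σ j =
    trans (cong (_xor σ (suc (toℕ j))) (rail-inject₁ σ j)) (sym (parity-snoc (suc (toℕ j)) σ))

  rail-last : ∀ σ → rail σ (fromℕ m) ≡ parity (suc m) σ
  rail-last σ = cong (λ t → parity (suc t) σ) (toℕ-fromℕ m)

  -- 0 exactly at the source and on the rail that a conducting path uses under σ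
  offRail : (ℕ → Bool) → Node m → Bool
  offRail σ source     = false
  offRail σ (rung j r) = r xor rail σ j

  offRail-preserved : ∀ σ x → litVal (literal x) σ ≡ true → offRail σ (lower x) ≡ offRail σ (upper x)
  offRail-preserved σ (enter c)     holds =
    sym (trans (cong (c xor_) (trans (rail-zero σ) (lit⁻ holds))) (xor-same c))
  offRail-preserved σ (climb j p c) holds = begin
    p xor rail σ (inject₁ j)               ≡⟨ cong (p xor_) (rail-inject₁ σ j) ⟩
    p xor q                                ≡⟨ xor-cancelʳ p q c ⟨
    (p xor c) xor (q xor c)                ≡⟨ cong (λ v → (p xor c) xor (q xor v)) (lit⁻ holds) ⟨
    (p xor c) xor (q xor σ (suc (toℕ j)))  ≡⟨ cong ((p xor c) xor_) (parity-snoc (suc (toℕ j)) σ) ⟨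
    (p xor c) xor rail σ (suc j)           ∎
    where
    open ≡-Reasoning
    q = parity (suc (toℕ j)) σ

  Good : (ℕ → Bool) → Fin #edges → Set
  Good σ e = litVal (literal (edgeAt e)) σ ≡ true

  conducts⇒parity : ∀ {C} σ → Conducts ladder (emptyFault {C} ladder) σ → parity (suc m) σ ≡ b
  conducts⇒parity σ (_ , (_ , W , _) , goods) = xor≡false⇒≡ b _ (sym (begin
    false                                          ≡⟨ cong (offRail σ) (decode-code source) ⟨
    offRail σ (decode (code source))
      ≡⟨ walk-invariant (offRail σ ∘ decode) (Good σ) preserved W goods ⟩
    offRail σ (decode (code (rung (fromℕ m) b)))   ≡⟨ cong (offRail σ) (decode-code (rung (fromℕ m) b)) ⟩
    b xor rail σ (fromℕ m)                         ≡⟨ cong (b xor_) (rail-last σ) ⟩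
    b xor parity (suc m) σ                         ∎))
    where
    open ≡-Reasoning
    preserved : ∀ e → Good σ e → offRail σ (decode (lowerEnd e)) ≡ offRail σ (decode (upperEnd e))
    preserved e holds = subst₂ _≡_ (cong (offRail σ) (sym (decode-code (lower (edgeAt e)))))
                                     (cong (offRail σ) (sym (decode-code (upper (edgeAt e)))))
                                     (offRail-preserved σ (edgeAt e) holds)

  edgeCode-good : ∀ σ x → litVal (literal x) σ ≡ true → Good σ (edgeCode x)
  edgeCode-good σ x holds = subst (λ y → litVal (literal y) σ ≡ true) (sym (edgeAt-edgeCode x)) holds

  Ascent : (ℕ → Bool) → Fin (suc m) → Set
  Ascent σ j = ∀ {r} → r ≡ rail σ j → ∃[ es ] ∃[ vs ]
    Walk (code (rung j r)) (code (rung (fromℕ m) (rail σ (fromℕ m)))) es vs ×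
    All (Good σ) es × Linked (_<_ on height) vs

  ascent : ∀ σ j → Ascent σ j
  ascent σ = >-weakInduction (Ascent σ) (λ { refl → [] , _ , stop , [] , [-] }) extend-down
    where
    extend-down : ∀ i → Ascent σ (suc i) → Ascent σ (inject₁ i)
    extend-down i ascent-suc refl with ascent-suc (rail-climb σ i)
    ... | es , vs , W , goods , ascending =
      edgeCode x ∷ es , _ , step (edgeCode x) (edgeCode-joins x) W ,
      edgeCode-good σ x (lit⁺ {σ = σ} refl) ∷ goods , linked-prepend (ascends x) W ascending
      where
      x = climb i (rail σ (inject₁ i)) (σ (suc (toℕ i)))

  parity⇒conducts : ∀ {C} σ → parity (suc m) σ ≡ b → Conducts ladder (emptyFault {C} ladder) σ
  parity⇒conducts σ parity≡b with ascent σ zero (sym (rail-zero σ))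
  ... | es , vs , W , goods , ascending =
    edgeCode x ∷ es ,
    (_ , subst (λ r → Walk (code source) (code (rung (fromℕ m) r)) (edgeCode x ∷ es) _)
               (trans (rail-last σ) parity≡b) (step (edgeCode x) (edgeCode-joins x) W) ,
         ascending⇒unique height (linked-prepend (ascends x) W ascending)) ,
    edgeCode-good σ x (lit⁺ {σ = σ} refl) ∷ goods
    where
    x = enter (σ 0)

  ladder-function : ∀ σ → Conducts ladder (emptyFault {C01} ladder) σ ⇔ (parity (suc m) σ ≡ b)
  ladder-function σ = mk⇔ (conducts⇒parity {C01} σ) (parity⇒conducts {C01} σ)

-- Decision trees and faults

restrict : (xs : List ℕ) → (ℕ → Bool) → Vec Bool (length xs)
restrict []       σ = []
restrict (x ∷ xs) σ = σ x ∷ restrict xs σ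

assign-restrict : ∀ xs σ {x} → x ∈ xs → assign xs (restrict xs σ) x ≡ σ x
assign-restrict (y ∷ xs) σ {x} x∈ with x ≡ᵇ y in x≡ᵇy | x∈
... | true  | _          = cong σ (sym (≡ᵇ⇒≡ x y (subst T (sym x≡ᵇy) tt)))
... | false | here refl  = contradiction (subst T x≡ᵇy (≡⇒≡ᵇ x x refl)) id
... | false | there x∈xs = assign-restrict xs σ x∈xs

module Diagnosis (Q : Network) where

  assignment : Vec Bool (nVars Q) → ℕ → Bool
  assignment = assign (inputVars Q)

  Answer : ∀ {c} → Fault c Q → Vec Bool (nVars Q) → Set
  Answer ρ τ = Conducts Q ρ (assignment τ)

  value : (ℕ → Bool) → Fin (L Q) → Bool
  value σ e = litVal (label Q e) σ

  tuple : (ℕ → Bool) → Vec Bool (nVars Q)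
  tuple = restrict (inputVars Q)

  value-tuple : ∀ σ e → value (assignment (tuple σ)) e ≡ value σ e
  value-tuple σ e = litVal-cong (label Q e) (assign-restrict (inputVars Q) σ occurs)
    where
    occurs : Literal.var (label Q e) ∈ inputVars Q
    occurs = ∈-deduplicate⁺ ℕ._≟_ (∈-map⁺ (Literal.var ∘ label Q) (∈-allFin e))

  Paths : (Fin (L Q) → Set) → Set
  Paths P = ∃[ es ] (Graph.SimplePath (src Q) (tgt Q) (s Q) (t Q) es × All P es)

  paths-mono : ∀ {P P′ : Fin (L Q) → Set} → (∀ e → P e → P′ e) → Paths P → Paths P′
  paths-mono mono (es , path , holds) = es , path , All.map (mono _) holds

  paths-nonempty : ∀ {P} → Paths P → ∃ P
  paths-nonempty ([]     , (_ , Graph.stop , _) , []) = contradiction refl (poles≢ Q)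
  paths-nonempty (e ∷ es , _                    , p ∷ _) = e , p

  leftSpine rightSpine : ∀ {c} → DTree c Q → List (Vec Bool (nVars Q))
  leftSpine (leaf _)       = []
  leftSpine (node τ t₀ t₁) = τ ∷ leftSpine t₀
  rightSpine (leaf _)       = []
  rightSpine (node τ t₀ t₁) = τ ∷ rightSpine t₁

  leftmost rightmost : ∀ {c} → DTree c Q → Fault c Q
  leftmost (leaf δ)       = δ
  leftmost (node τ t₀ t₁) = leftmost t₀
  rightmost (leaf δ)       = δ
  rightmost (node τ t₀ t₁) = rightmost t₁

  length-leftSpine : ∀ {c} (T : DTree c Q) → length (leftSpine T) ≤ depth T
  length-leftSpine (leaf _)       = z≤n
  length-leftSpine (node τ t₀ t₁) = s≤s (≤-trans (length-leftSpine t₀) (m≤m⊔n _ _))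

  length-rightSpine : ∀ {c} (T : DTree c Q) → length (rightSpine T) ≤ depth T
  length-rightSpine (leaf _)       = z≤n
  length-rightSpine (node τ t₀ t₁) = s≤s (≤-trans (length-rightSpine t₁) (m≤n⊔m _ _))

  reaches-leftmost : ∀ {c} (T : DTree c Q) {ρ} →
                     All (¬_ ∘ Answer ρ) (leftSpine T) → Reaches T ρ (leftmost T)
  reaches-leftmost (leaf δ)       []         = atLeaf
  reaches-leftmost (node τ t₀ t₁) (¬a ∷ ¬as) = go0 ¬a (reaches-leftmost t₀ ¬as)

  reaches-rightmost : ∀ {c} (T : DTree c Q) {ρ} →
                      All (Answer ρ) (rightSpine T) → Reaches T ρ (rightmost T)
  reaches-rightmost (leaf δ)       []       = atLeaf
  reaches-rightmost (node τ t₀ t₁) (a ∷ as) = go1 a (reaches-rightmost t₁ as)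

  leftSpine-separates : ∀ {c} {T : DTree c Q} → Diagnoses T → ∀ ρ₀ ρ {τ} →
                        (∀ τ → ¬ Answer ρ₀ τ) → Answer ρ τ → ¬ All (¬_ ∘ Answer ρ) (leftSpine T)
  leftSpine-separates {T = T} diagnoses ρ₀ ρ {τ} silent answer ¬answers =
    silent τ (Equivalence.from (diagnoses ρ₀ _ (reaches-leftmost T (All.tabulate λ _ → silent _)) τ)
             (Equivalence.to (diagnoses ρ _ (reaches-leftmost T ¬answers) τ) answer))

  rightSpine-separates : ∀ {c} {T : DTree c Q} → Diagnoses T → ∀ ρ₁ ρ {τ} →
                         (∀ τ → Answer ρ₁ τ) → ¬ Answer ρ τ → ¬ All (Answer ρ) (rightSpine T)
  rightSpine-separates {T = T} diagnoses ρ₁ ρ {τ} always ¬answer answers =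
    ¬answer (Equivalence.from (diagnoses ρ _ (reaches-rightmost T answers) τ)
            (Equivalence.to (diagnoses ρ₁ _ (reaches-rightmost T (All.tabulate λ _ → always _)) τ) (always τ)))

  stuckAt : ∀ {c} b → Allowed c b → (Fin (L Q) → Bool) → Fault c Q
  stuckAt {c} b allowed stuck = record
    { const   = λ e → if stuck e then just b else nothing
    ; allowed = λ e b′ → stuck-allowed (stuck e) }
    where
    stuck-allowed : ∀ s {b′} → (if s then just b else nothing) ≡ just b′ → Allowed c b′
    stuck-allowed true  eq = subst (Allowed c) (just-injective eq) allowed
    stuck-allowed false ()

  constFault : ∀ {c} b → Allowed c b → Fault c Q
  constFault b allowed = stuckAt b allowed λ _ → true

  conjFault : ∀ {c} → Allowed c false → (ℕ → Bool) → Fault c Q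
  conjFault allowed α = stuckAt false allowed (not ∘ value α)

  disjFault : ∀ {c} → Allowed c true → (ℕ → Bool) → Fault c Q
  disjFault allowed α = stuckAt true allowed (value α)

  constFault-false-silent : ∀ {c} (allowed : Allowed c false) σ → ¬ Conducts Q (constFault false allowed) σ
  constFault-false-silent allowed σ conducts = contradiction (proj₂ (paths-nonempty conducts)) λ ()

  edgeVal-conjFault : ∀ {c} (allowed : Allowed c false) α e σ →
                      edgeVal Q (conjFault allowed α) e σ ≡ value α e ∧ value σ e
  edgeVal-conjFault allowed α e σ with value α e
  ... | true  = refl
  ... | false = refl

  edgeVal-disjFault : ∀ {c} (allowed : Allowed c true) α e σ →
                      edgeVal Q (disjFault allowed α) e σ ≡ value α e ∨ value σ e
  edgeVal-disjFault allowed α e σ with value α e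
  ... | true  = refl
  ... | false = refl

-- The lower bounds

module LowerBound (Q : Network) (n : ℕ) (b : Bool)
                  (implements : ∀ σ → Conducts Q (emptyFault {C01} Q) σ ⇔ (parity n σ ≡ b)) where

  open Diagnosis Q
  open import Data.List.Membership.DecPropositional (≡-dec {n = n} Bool._≟_) using (_∈?_)

  toggle-rejected : ∀ {α} → parity n α ≡ b → ∀ {i} → i < n →
                    ¬ Conducts Q (emptyFault {C01} Q) (toggle i α)
  toggle-rejected {α} accepted {i} i<n conducts = Bool.not-¬ refl (begin
    parity n α             ≡⟨ accepted ⟩
    b                      ≡⟨ Equivalence.to (implements _) conducts ⟨
    parity n (toggle i α)  ≡⟨ parity-toggle α i<n ⟩
    not (parity n α)       ∎)
    where open ≡-Reasoning

  toggle-accepted : ∀ {α} → parity n α ≢ b → ∀ {i} → i < n →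
                    Conducts Q (emptyFault {C01} Q) (toggle i α)
  toggle-accepted {α} rejected i<n = Equivalence.from (implements _)
    (trans (parity-toggle α i<n) (sym (Bool.¬-not (rejected ∘ sym))))

  prefixes : List (Vec Bool (nVars Q)) → List (Vec Bool n)
  prefixes = map (prefix n ∘ assignment)

  covers-prefixes⇒C≤length : ∀ k X → Covers k (prefixes X) → n C k ≤ length X
  covers-prefixes⇒C≤length k X covers =
    ≤-trans (covers⇒C≤length n k _ covers) (≤-reflexive (length-map _ X))

  conjFault-accepts : ∀ {c} (allowed : Allowed c false) {α} → parity n α ≡ b →
                      Answer (conjFault allowed α) (tuple α)
  conjFault-accepts allowed {α} accepted =
    paths-mono restricted (Equivalence.from (implements α) accepted)
    where
    restricted : ∀ e → value α e ≡ true → edgeVal Q (conjFault allowed α) e (assignment (tuple α)) ≡ true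
    restricted e α⊨e =
      trans (edgeVal-conjFault allowed α e _) (cong₂ _∧_ α⊨e (trans (value-tuple α e) α⊨e))

  conjFault-agrees : ∀ {c} (allowed : Allowed c false) {α σ} → parity n α ≡ b →
                     Conducts Q (conjFault allowed α) σ → AgreeBelow n σ α
  conjFault-agrees allowed {α} {σ} accepted conducts i i<n with σ i Bool.≟ α i
  ... | yes σi≡αi = σi≡αi
  ... | no  σi≢αi = contradiction (paths-mono toggled conducts) (toggle-rejected accepted i<n)
    where
    toggled : ∀ e → edgeVal Q (conjFault allowed α) e σ ≡ true → value (toggle i α) e ≡ true
    toggled e holds with ∧≡true⁻ (value α e) (trans (sym (edgeVal-conjFault allowed α e σ)) holds)
    ... | α⊨e , σ⊨e with Literal.var (label Q e) ℕ.≟ i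
    ...   | yes refl  = contradiction (satisfiers-agree (label Q e) σ⊨e α⊨e) σi≢αi
    ...   | no  var≢i = trans (litVal-cong (label Q e) (toggle-other i α var≢i)) α⊨e

  leftSpine-covers : ∀ {c} (allowed : Allowed c false) {T : DTree c Q} → Diagnoses T →
                     ∀ α → parity n (extend α) ≡ b → α ∈ prefixes (leftSpine T)
  leftSpine-covers allowed {T} diagnoses α accepted with α ∈? prefixes (leftSpine T)
  ... | yes α∈ = α∈
  ... | no  α∉ = contradiction (All.tabulate rejects)
    (leftSpine-separates diagnoses (constFault false allowed) (conjFault allowed (extend α))
      (constFault-false-silent allowed ∘ assignment) (conjFault-accepts allowed accepted))
    where
    rejects : ∀ {τ} → τ ∈ leftSpine T → ¬ Answer (conjFault allowed (extend α)) τ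
    rejects {τ} τ∈ answer = α∉ (subst (_∈ prefixes (leftSpine T))
      (prefix-extend (assignment τ) α (conjFault-agrees allowed accepted answer)) (∈-map⁺ _ τ∈))

  stuck-at-0-bound : ∀ {c} → Allowed c false → ∀ k → odd k ≡ b →
                     (T : DTree c Q) → Diagnoses T → n C k ≤ depth T
  stuck-at-0-bound allowed k odd≡b T diagnoses =
    ≤-trans (covers-prefixes⇒C≤length k (leftSpine T) covers) (length-leftSpine T)
    where
    covers : Covers k (prefixes (leftSpine T))
    covers α weight≡k = leftSpine-covers allowed diagnoses α
      (trans (parity-extend α) (trans (cong odd weight≡k) odd≡b))

  constFault-true-answers : ∀ {c} (allowed : Allowed c true) → 0 < n →
                            ∀ σ → Conducts Q (constFault true allowed) σ
  constFault-true-answers allowed 0<n σ with parity-surjective 0<n b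
  ... | σ₀ , accepted = paths-mono (λ _ _ → refl) (Equivalence.from (implements σ₀) accepted)

  disjFault-rejects : ∀ {c} (allowed : Allowed c true) {α} → parity n α ≢ b →
                      ¬ Answer (disjFault allowed α) (tuple α)
  disjFault-rejects allowed {α} rejected answer =
    rejected (Equivalence.to (implements α) (paths-mono unrestricted answer))
    where
    unrestricted : ∀ e → edgeVal Q (disjFault allowed α) e (assignment (tuple α)) ≡ true → value α e ≡ true
    unrestricted e holds with ∨≡true⁻ (value α e) (trans (sym (edgeVal-disjFault allowed α e _)) holds)
    ... | inj₁ α⊨e = α⊨e
    ... | inj₂ α⊨e = trans (sym (value-tuple α e)) α⊨e

  disjFault-accepts : ∀ {c} (allowed : Allowed c true) {α} → parity n α ≢ b →
                      ∀ {σ i} → i < n → σ i ≢ α i → Conducts Q (disjFault allowed α) σ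
  disjFault-accepts allowed {α} rejected {σ} {i} i<n σi≢αi =
    paths-mono toggled (toggle-accepted rejected i<n)
    where
    toggled : ∀ e → value (toggle i α) e ≡ true → edgeVal Q (disjFault allowed α) e σ ≡ true
    toggled e holds =
      trans (edgeVal-disjFault allowed α e σ) (∨≡true⁺ (α-or-σ (Literal.var (label Q e) ℕ.≟ i)))
      where
      α-or-σ : Dec (Literal.var (label Q e) ≡ i) → value α e ≡ true ⊎ value σ e ≡ true
      α-or-σ (yes refl)  = inj₂ (trans (litVal-cong (label Q e) σi≡toggled) holds)
        where σi≡toggled = trans (Bool.¬-not σi≢αi) (sym (toggle-self i α))
      α-or-σ (no  var≢i) = inj₁ (trans (litVal-cong (label Q e) (sym (toggle-other i α var≢i))) holds)

  rightSpine-covers : ∀ {c} (allowed : Allowed c true) → 0 < n → {T : DTree c Q} → Diagnoses T →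
                      ∀ α → parity n (extend α) ≢ b → α ∈ prefixes (rightSpine T)
  rightSpine-covers allowed 0<n {T} diagnoses α rejected with α ∈? prefixes (rightSpine T)
  ... | yes α∈ = α∈
  ... | no  α∉ = contradiction (All.tabulate accepts)
    (rightSpine-separates diagnoses (constFault true allowed) (disjFault allowed (extend α))
      (constFault-true-answers allowed 0<n ∘ assignment) (disjFault-rejects allowed rejected))
    where
    accepts : ∀ {τ} → τ ∈ rightSpine T → Answer (disjFault allowed (extend α)) τ
    accepts {τ} τ∈ with prefix-≢ (assignment τ) α (λ eq → α∉ (subst (_∈ _) eq (∈-map⁺ _ τ∈)))
    ... | i , i<n , differs = disjFault-accepts allowed rejected i<n differs

  stuck-at-1-bound : ∀ {c} → Allowed c true → 0 < n → ∀ k → odd k ≢ b →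
                     (T : DTree c Q) → Diagnoses T → n C k ≤ depth T
  stuck-at-1-bound allowed 0<n k odd≢b T diagnoses =
    ≤-trans (covers-prefixes⇒C≤length k (rightSpine T) covers) (length-rightSpine T)
    where
    covers : Covers k (prefixes (rightSpine T))
    covers α weight≡k = rightSpine-covers allowed 0<n diagnoses α
      (odd≢b ∘ trans (sym (trans (parity-extend α) (cong odd weight≡k))))

-- makes every vector of weight k accepted for faults with 0 and rejected for faults with 1
targetParity : FaultType → ℕ → Bool
targetParity C01 k = odd k
targetParity C0  k = odd k
targetParity C1  k = not (odd k)

ladder-parity : ∀ m b (Q : Network) → SameFunction Q (Ladder.ladder m b) →
                ∀ σ → Conducts Q (emptyFault {C01} Q) σ ⇔ (parity (suc m) σ ≡ b)
ladder-parity m b Q same σ = ⇔.trans (same σ) (Ladder.ladder-function m b σ)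

ladder-bound : ∀ c m (Q : Network) → SameFunction Q (Ladder.ladder m (targetParity c ⌈ suc m /2⌉)) →
               (T : DTree c Q) → Diagnoses T → suc m C ⌈ suc m /2⌉ ≤ depth T
ladder-bound C01 m Q same =
  LowerBound.stuck-at-0-bound Q (suc m) _ (ladder-parity m _ Q same) tt ⌈ suc m /2⌉ refl
ladder-bound C0  m Q same =
  LowerBound.stuck-at-0-bound Q (suc m) _ (ladder-parity m _ Q same) refl ⌈ suc m /2⌉ refl
ladder-bound C1  m Q same =
  LowerBound.stuck-at-1-bound Q (suc m) _ (ladder-parity m _ Q same) refl (s≤s z≤n) ⌈ suc m /2⌉
    (Bool.not-¬ refl)

theorem2 : (c : FaultType) (n : ℕ) → n ≥ 1 →
    Σ Network (λ P → nVars P ≡ n × L P ≡ n * n + n ×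
      ((Q : Network) → SameFunction Q P →
        (T : DTree c Q) → Diagnoses T → n C ⌈ n /2⌉ ≤ depth T))
theorem2 c zero    ()
theorem2 c (suc m) _ = ladder , ladder-nVars , ladder-L , ladder-bound c m
  where open Ladder m (targetParity c ⌈ suc m /2⌉)
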